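{- Let $G=(V,E)$ be a graph with at least two vertices and no isolated vertices, let $E$ also denote its graph CNF $\bigwedge_{\{x,y\}\in E}(x\vee y)$, and let $D$ be a nice DNNF equivalent to $E$. Let $v$ be a gate of $D$ and let $M$ be a matching in $G$ between $\mathsf{vars}(\mathsf{sub}(D,v))$ and $\mathsf{vars}(D)\setminus\mathsf{vars}(\mathsf{sub}(D,v))$. Then there exists $I_v\subseteq V$ with $|I_v|=|M|$ such that for all $T\in\mathsf{cert}(D)$ with $v\in T$ we have $I_v\subseteq\mathsf{vars}(T)$.
   Context: An NNF is a finite directed acyclic graph whose nodes (gates) are labelled and whose arcs are called wires, with a unique sink (the output gate); source nodes (input gates) are labelled by $0$, $1$, $x$ or $\neg x$ for variables $x$, non-source nodes by $\wedge$ or $\vee$. $\mathsf{vars}(C)$ is the set of variables in input-gate labels; the fanin of a gate is its number of incoming wires; an NNF is equivalent to a CNF if they take the same value under every assignment. For a gate $v$, $\mathsf{sub}(C,v)$ is the NNF consisting of $v$ and all gates with a directed path to $v$. A DNNF is an NNF in which, for every $\wedge$-gate with input wires from $v_1,\dots,v_i$, the sets $\mathsf{vars}(\mathsf{sub}(D,v_j))$ are pairwise disjoint; it is nice if every gate has fanin at most $2$ and no input gate is labelled by a constant or a negated variable. A certificate of an NNF $C$ is an NNF $T$ whose gates and wires are subsets of those of $C$ (same labels) such that: the output gate of $T$ is that of $C$; if a gate $u$ of $T$ is an $\wedge$-gate of $C$ with inputs $u_1,\dots,u_i$, all $u_j$ and wires $(u_j,u)$ are in $T$; if $u$ of $T$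 is an $\vee$-gate of $C$ with inputs $u_1,\dots,u_i$, exactly one $w\in\{u_1,\dots,u_i\}$ and the wire $(w,u)$ are in $T$. $\mathsf{cert}(C)$ is the set of certificates. A matching is a set of pairwise disjoint edges; a matching between disjoint vertex sets $V',V''$ is one in which every edge meets both $V'$ and $V''$. -}

module Defs where

open import Data.Nat using (ℕ; suc; _<_; _≤_)
open import Data.Fin using (Fin; toℕ)
open import Data.Fin.Subset using (Subset)
open import Data.Bool using (Bool; true; false; not)
open import Data.List using (List; []; _∷_; length; concatMap)
open import Data.List.Relation.Unary.All using (All)
open import Data.List.Relation.Unary.Any using (Any)
open import Data.List.Relation.Unary.Unique.Propositional using (Unique)
open import Data.List.Membership.Propositional using (_∈_)
open import Data.Product using (Σ; ∃; _×_; _,_)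
open import Data.Sum using (_⊎_)
open import Data.Unit using (⊤)
open import Data.Empty using (⊥)
open import Relation.Binary.PropositionalEquality using (_≡_; _≢_)
open import Relation.Nullary using (¬_)
open import Relation.Binary using (Decidable)

data Label (n : ℕ) : Set where
  const : Bool → Label n
  pos   : Fin n → Label n
  neg   : Fin n → Label n
  and   : Label n
  or    : Label n

IsInputLabel : ∀ {n} → Label n → Set
IsInputLabel (const _) = ⊤
IsInputLabel (pos _)   = ⊤
IsInputLabel (neg _)   = ⊤
IsInputLabel and       = ⊥
IsInputLabel or        = ⊥

-- NNF: a finite DAG, gates Fin size, given in topological order.
-- inputs g lists the gates u with a wire (u , g); no parallel wires.

record NNF (n : ℕ) : Set where
  field
    size     : ℕ
    label    : Fin size → Label n
    inputs   : Fin size → List (Fin size)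
    distinct : ∀ g → Unique (inputs g)
    acyclic  : ∀ g u → u ∈ inputs g → toℕ u < toℕ g
    source⇔input : ∀ g → (inputs g ≡ []) × IsInputLabel (label g)
                       ⊎ (¬ inputs g ≡ []) × ¬ IsInputLabel (label g)
    out      : Fin size
    out-sink : ∀ g → ¬ out ∈ inputs g
    unique-sink : ∀ u → u ≢ out → ∃ λ g → u ∈ inputs g

module _ {n : ℕ} (C : NNF n) where
  open NNF C

  Wire : Fin size → Fin size → Set
  Wire u w = u ∈ inputs w

  data Reach : Fin size → Fin size → Set where
    here : ∀ {u} → Reach u u
    step : ∀ {u w z} → Wire u w → Reach w z → Reach u z

  VarAt : Fin size → Fin n → Set
  VarAt g x = label g ≡ pos x ⊎ label g ≡ neg x

  vars : Fin n → Set
  vars x = ∃ λ g → VarAt g x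

  -- vars(sub(C,v)): sub(C,v) consists of the gates with a path to v
  varsSub : Fin size → Fin n → Set
  varsSub v x = ∃ λ g → Reach g v × VarAt g x

  data Eval (a : Fin n → Bool) : Fin size → Bool → Set where
    ev-const : ∀ {g b} → label g ≡ const b → Eval a g b
    ev-pos   : ∀ {g x} → label g ≡ pos x → Eval a g (a x)
    ev-neg   : ∀ {g x} → label g ≡ neg x → Eval a g (not (a x))
    ev-and-t : ∀ {g} → label g ≡ and → All (λ u → Eval a u true) (inputs g) → Eval a g true
    ev-and-f : ∀ {g} → label g ≡ and → Any (λ u → Eval a u false) (inputs g) → Eval a g false
    ev-or-t  : ∀ {g} → label g ≡ or → Any (λ u → Eval a u true) (inputs g) → Eval a g true
    ev-or-f  : ∀ {g} → label g ≡ or → All (λ u → Eval a u false) (inputs g) → Eval a g false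

  Sat : (Fin n → Bool) → Set
  Sat a = Eval a out true

  IsDNNF : Set
  IsDNNF = ∀ g → label g ≡ and → ∀ u₁ u₂ → u₁ ∈ inputs g → u₂ ∈ inputs g →
           u₁ ≢ u₂ → ∀ x → ¬ (varsSub u₁ x × varsSub u₂ x)

  IsNice : Set
  IsNice = (∀ g → length (inputs g) ≤ 2)
         × (∀ g b → label g ≢ const b)
         × (∀ g x → label g ≢ neg x)

  record Certificate : Set₁ where
    field
      inT   : Fin size → Set
      wT    : Fin size → Fin size → Set
      wT-wire : ∀ u w → wT u w → Wire u w
      wT-ends : ∀ u w → wT u w → inT u × inT w
      out-in  : inT out
      -- T is an NNF with output gate out: out is its unique sink
      T-sink  : ∀ u → inT u → u ≢ out → ∃ λ w → wT u w
      and-all : ∀ u → inT u → label u ≡ and → ∀ w → w ∈ inputs u → inT w × wT w u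
      or-one  : ∀ u → inT u → label u ≡ or →
                ∃ λ w → w ∈ inputs u × inT w × wT w u × (∀ w' → wT w' u → w' ≡ w)

    varsT : Fin n → Set
    varsT x = ∃ λ g → inT g × VarAt g x

record Graph (n : ℕ) : Set₁ where
  field
    Adj    : Fin n → Fin n → Set
    dec    : Decidable Adj
    sym    : ∀ {x y} → Adj x y → Adj y x
    irrefl : ∀ {x} → ¬ Adj x x

GraphCNF : ∀ {n} → Graph n → (Fin n → Bool) → Set
GraphCNF G a = ∀ x y → Graph.Adj G x y → a x ≡ true ⊎ a y ≡ true

NoIsolated : ∀ {n} → Graph n → Set
NoIsolated G = ∀ x → ∃ λ y → Graph.Adj G x y

-- a matching given as a list of edges (x , y); all 2|M| endpoints distinct
endpoints : ∀ {n} → List (Fin n × Fin n) → List (Fin n)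
endpoints = concatMap (λ { (x , y) → x ∷ y ∷ [] })

MatchingBetween : ∀ {n} → Graph n → (A B : Fin n → Set) → List (Fin n × Fin n) → Set
MatchingBetween G A B M =
  All (λ { (x , y) → Graph.Adj G x y × A x × B y }) M × Unique (endpoints M)

-- Each edge xy of M has x below v and y not below v, and M's endpoints are distinct, so it suffices
-- to find one endpoint of each edge lying in every certificate through v.  Let a set x false and all
-- other variables true.  If v is false under a, descending along false gates in a certificate through
-- v ends in a false literal, necessarily x.  Otherwise let a′ also set y false: v stays true (y does
-- not occur below v) and the output becomes false (the clause x ∨ y fails), so descending from the
-- output of a certificate T ∋ v reaches a false literal x or y.  Decomposability at ∧-gates and the
-- single chosen input at ∨-gates keep every gate of this descent that mentions x on the T-path from v
-- to the output; a literal x there would be v itself, which is true.  Hence y ∈ vars(T).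
module Submission where

open import Defs
open import Data.Nat using (zero; suc; _≤_; _<_; _+_)
open import Data.Nat.Properties
  using (≤-refl; ≤-trans; ≤-pred; ≤-reflexive; +-suc; +-monoˡ-≤; +-identityʳ; m≤n+m; <⇒≱)
open import Data.Fin using (Fin; toℕ; _≟_)
open import Data.Fin.Properties using (toℕ<n)
open import Data.Fin.Subset using (Subset; _∈_; _∉_; ∣_∣; ⁅_⁆; _∪_; inside; outside)
open import Data.Fin.Subset.Properties using (∣⊥∣≡0; ∉⊥; ∪-identityˡ; x∈p∪q⁻; x∈⁅y⁆⇒x≡y)
import Data.Fin.Subset as Subset
open import Data.Vec using (_∷_; here; there)
open import Data.Bool using (Bool; true; false; not; if_then_else_)
open import Data.List using (List; []; _∷_; length)
open import Data.List.Relation.Unary.All as All using (All; []; _∷_)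
open import Data.List.Relation.Unary.Any using (Any; here; there)
open import Data.List.Relation.Unary.Any.Properties using (¬Any[])
open import Data.List.Relation.Unary.AllPairs using ([]; _∷_)
open import Data.List.Relation.Unary.Unique.Propositional using (Unique)
open import Data.List.Membership.Propositional using () renaming (_∈_ to _∈ₗ_)
open import Data.Product using (Σ; ∃; _×_; _,_; proj₁; proj₂; map₂)
open import Data.Sum using (_⊎_; inj₁; inj₂; [_,_]′; swap) renaming (map to map⊎)
open import Data.Empty using (⊥; ⊥-elim)
open import Data.Unit using (⊤; tt)
open import Function using (_∘_)
open import Function.Bundles using (_⇔_; Equivalence)
open import Relation.Binary.PropositionalEquality using (_≡_; _≢_; refl; sym; trans; cong; subst)
open import Relation.Nullary using (¬_; yes; no; does; contradiction)

∣⁅x⁆∪p∣≡1+∣p∣ : ∀ {n} {x : Fin n} (p : Subset n) → x ∉ p → ∣ ⁅ x ⁆ ∪ p ∣ ≡ suc ∣ p ∣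
∣⁅x⁆∪p∣≡1+∣p∣ {x = Fin.zero} (outside ∷ p) x∉p = cong (suc ∘ ∣_∣) (∪-identityˡ p)
∣⁅x⁆∪p∣≡1+∣p∣ {x = Fin.zero} (inside ∷ p) x∉p = contradiction here x∉p
∣⁅x⁆∪p∣≡1+∣p∣ {x = Fin.suc x} (outside ∷ p) x∉p = ∣⁅x⁆∪p∣≡1+∣p∣ p (x∉p ∘ there)
∣⁅x⁆∪p∣≡1+∣p∣ {x = Fin.suc x} (inside ∷ p) x∉p = cong suc (∣⁅x⁆∪p∣≡1+∣p∣ p (x∉p ∘ there))

setFalse : ∀ {n} → Fin n → (Fin n → Bool) → Fin n → Bool
setFalse x a z = if does (z ≟ x) then false else a z

module _ {n} (x : Fin n) (a : Fin n → Bool) where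

  setFalse-same : setFalse x a x ≡ false
  setFalse-same with x ≟ x
  ... | yes _ = refl
  ... | no x≢x = contradiction refl x≢x

  setFalse-other : ∀ {z} → z ≢ x → setFalse x a z ≡ a z
  setFalse-other {z} z≢x with z ≟ x
  ... | yes z≡x = contradiction z≡x z≢x
  ... | no _ = refl

  setFalse-keeps-false : ∀ {z} → a z ≡ false → setFalse x a z ≡ false
  setFalse-keeps-false {z} az with z ≟ x
  ... | yes _ = refl
  ... | no _ = az

  setFalse-false⁻ : ∀ {z} → setFalse x a z ≡ false → z ≡ x ⊎ a z ≡ false
  setFalse-false⁻ {z} eq with z ≟ x
  ... | yes z≡x = inj₁ z≡x
  ... | no _ = inj₂ eq

module _ {n} (D : NNF n) where
  open NNF D

  Reach-trans : ∀ {u w z} → Reach D u w → Reach D w z → Reach D u z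
  Reach-trans here r = r
  Reach-trans (step uq q↝w) r = step uq (Reach-trans q↝w r)

  varsSub-mono : ∀ {u w x} → Reach D u w → varsSub D u x → varsSub D w x
  varsSub-mono u↝w (g , g↝u , gx) = g , Reach-trans g↝u u↝w , gx

  no-wire-into-input : ∀ {g u l} → label g ≡ l → IsInputLabel l → ¬ Wire D u g
  no-wire-into-input {g} eq isInput u→g with source⇔input g
  ... | inj₁ (noInputs , _) = ¬Any[] (subst (_ ∈ₗ_) noInputs u→g)
  ... | inj₂ (_ , notInput) = notInput (subst IsInputLabel (sym eq) isInput)

all⊎any : ∀ {a p q} {A : Set a} {P : A → Set p} {Q : A → Set q} (xs : List A) →
          (∀ {x} → x ∈ₗ xs → P x ⊎ Q x) → All P xs ⊎ Any Q xs
all⊎any [] _ = inj₁ []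
all⊎any (x ∷ xs) pq with pq (here refl) | all⊎any xs (pq ∘ there)
... | inj₂ qx | _ = inj₂ (here qx)
... | inj₁ px | inj₁ pxs = inj₁ (px ∷ pxs)
... | inj₁ _ | inj₂ qxs = inj₂ (there qxs)

module _ {n} (D : NNF n) (a : Fin n → Bool) where
  open NNF D

  Evaluates : Fin size → Set
  Evaluates g = Eval D a g true ⊎ Eval D a g false

  private
    evaluates : ∀ {g} b → Eval D a g b → Evaluates g
    evaluates true e = inj₁ e
    evaluates false e = inj₂ e

    evalBelow : ∀ k g → toℕ g < k → Evaluates g
    evalBelow (suc k) g g<1+k = byLabel (label g) refl
      where
        input : ∀ {u} → u ∈ₗ inputs g → Evaluates u
        input u∈ = evalBelow k _ (≤-trans (acyclic g _ u∈) (≤-pred g<1+k))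

        byLabel : ∀ l → label g ≡ l → Evaluates g
        byLabel (const b) eq = evaluates b (ev-const eq)
        byLabel (pos x) eq = evaluates (a x) (ev-pos eq)
        byLabel (neg x) eq = evaluates (not (a x)) (ev-neg eq)
        byLabel and eq = map⊎ (ev-and-t eq) (ev-and-f eq) (all⊎any (inputs g) input)
        byLabel or eq = swap (map⊎ (ev-or-f eq) (ev-or-t eq) (all⊎any (inputs g) (swap ∘ input)))

  eval-total : ∀ g → Evaluates g
  eval-total g = evalBelow (suc (toℕ g)) g ≤-refl

  EvalStep : Fin size → Label n → Bool → Set
  EvalStep g (const c) b = b ≡ c
  EvalStep g (pos x) b = b ≡ a x
  EvalStep g (neg x) b = b ≡ not (a x)
  EvalStep g and b = b ≡ true × All (λ u → Eval D a u true) (inputs g)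
                   ⊎ b ≡ false × Any (λ u → Eval D a u false) (inputs g)
  EvalStep g or b = b ≡ true × Any (λ u → Eval D a u true) (inputs g)
                  ⊎ b ≡ false × All (λ u → Eval D a u false) (inputs g)

  eval-inversion : ∀ {g l b} → label g ≡ l → Eval D a g b → EvalStep g l b
  eval-inversion {g} {b = b} eq e = subst (λ l → EvalStep g l b) eq (invert e)
    where
      invert : ∀ {g b} → Eval D a g b → EvalStep g (label g) b
      invert (ev-const e) rewrite e = refl
      invert (ev-pos e) rewrite e = refl
      invert (ev-neg e) rewrite e = refl
      invert (ev-and-t e ts) rewrite e = inj₁ (refl , ts)
      invert (ev-and-f e fs) rewrite e = inj₂ (refl , fs)
      invert (ev-or-t e ts) rewrite e = inj₁ (refl , ts)
      invert (ev-or-f e fs) rewrite e = inj₂ (refl , fs)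

  eval-deterministic : ∀ {g b b′} → Eval D a g b → Eval D a g b′ → b ≡ b′
  all-any-clash : ∀ {b b′ us} → b ≢ b′ →
                  All (λ u → Eval D a u b) us → Any (λ u → Eval D a u b′) us → ⊥
  any-all-clash : ∀ {b b′ us} → b ≢ b′ →
                  Any (λ u → Eval D a u b) us → All (λ u → Eval D a u b′) us → ⊥

  eval-deterministic (ev-const eq) e′ = sym (eval-inversion eq e′)
  eval-deterministic (ev-pos eq) e′ = sym (eval-inversion eq e′)
  eval-deterministic (ev-neg eq) e′ = sym (eval-inversion eq e′)
  eval-deterministic (ev-and-t eq ts) e′ with eval-inversion eq e′
  ... | inj₁ (refl , _) = refl
  ... | inj₂ (refl , fs) = ⊥-elim (all-any-clash (λ ()) ts fs)
  eval-deterministic (ev-and-f eq fs) e′ with eval-inversion eq e′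
  ... | inj₁ (refl , ts) = ⊥-elim (any-all-clash (λ ()) fs ts)
  ... | inj₂ (refl , _) = refl
  eval-deterministic (ev-or-t eq ts) e′ with eval-inversion eq e′
  ... | inj₁ (refl , _) = refl
  ... | inj₂ (refl , fs) = ⊥-elim (any-all-clash (λ ()) ts fs)
  eval-deterministic (ev-or-f eq fs) e′ with eval-inversion eq e′
  ... | inj₁ (refl , ts) = ⊥-elim (all-any-clash (λ ()) fs ts)
  ... | inj₂ (refl , _) = refl

  all-any-clash b≢b′ (e ∷ _) (here e′) = b≢b′ (eval-deterministic e e′)
  all-any-clash b≢b′ (_ ∷ es) (there e′) = all-any-clash b≢b′ es e′

  any-all-clash b≢b′ (here e) (e′ ∷ _) = b≢b′ (eval-deterministic e e′)
  any-all-clash b≢b′ (there e) (_ ∷ es′) = any-all-clash b≢b′ e es′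

module _ {n} (D : NNF n) {a a′ : Fin n → Bool} where
  open NNF D

  AgreeBelow : Fin size → Set
  AgreeBelow g = ∀ {x} → varsSub D g x → a x ≡ a′ x

  private
    agree-input : ∀ {g u} → AgreeBelow g → u ∈ₗ inputs g → AgreeBelow u
    agree-input agree u∈ xu = agree (varsSub-mono D (step u∈ here) xu)

  eval-cong : ∀ {g b} → AgreeBelow g → Eval D a g b → Eval D a′ g b
  eval-cong-all : ∀ {b us} → (∀ {u} → u ∈ₗ us → AgreeBelow u) →
                  All (λ u → Eval D a u b) us → All (λ u → Eval D a′ u b) us
  eval-cong-any : ∀ {b us} → (∀ {u} → u ∈ₗ us → AgreeBelow u) →
                  Any (λ u → Eval D a u b) us → Any (λ u → Eval D a′ u b) us

  eval-cong agree (ev-const eq) = ev-const eq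
  eval-cong {g} agree (ev-pos eq) rewrite agree (g , here , inj₁ eq) = ev-pos eq
  eval-cong {g} agree (ev-neg eq) rewrite agree (g , here , inj₂ eq) = ev-neg eq
  eval-cong agree (ev-and-t eq es) = ev-and-t eq (eval-cong-all (agree-input agree) es)
  eval-cong agree (ev-and-f eq es) = ev-and-f eq (eval-cong-any (agree-input agree) es)
  eval-cong agree (ev-or-t eq es) = ev-or-t eq (eval-cong-any (agree-input agree) es)
  eval-cong agree (ev-or-f eq es) = ev-or-f eq (eval-cong-all (agree-input agree) es)

  eval-cong-all agree [] = []
  eval-cong-all agree (e ∷ es) = eval-cong (agree (here refl)) e ∷ eval-cong-all (agree ∘ there) es
  eval-cong-any agree (here e) = here (eval-cong (agree (here refl)) e)
  eval-cong-any agree (there es) = there (eval-cong-any (agree ∘ there) es)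

module _ {n} {D : NNF n} (T : Certificate D) where
  open NNF D
  open Certificate T

  data PathFrom (u : Fin size) : Fin size → Set where
    start : PathFrom u u
    _▷_ : ∀ {q w} → PathFrom u q → wT q w → PathFrom u w

  PathFrom⇒Reach : ∀ {u w} → PathFrom u w → Reach D u w
  PathFrom⇒Reach start = here
  PathFrom⇒Reach (u↝q ▷ q→w) = Reach-trans D (PathFrom⇒Reach u↝q) (step (wT-wire _ _ q→w) here)

  PathFrom-toOut : ∀ {u g} → inT g → PathFrom u g → PathFrom u out
  PathFrom-toOut {g = g} g∈T u↝g = go size g (m≤n+m size (toℕ g)) g∈T u↝g
    where
      -- Wires increase the gate index, so k bounds the length of the remaining walk to the sink.
      go : ∀ k g → size ≤ toℕ g + k → inT g → PathFrom _ g → PathFrom _ out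
      go zero g size≤g _ _ = contradiction (subst (size ≤_) (+-identityʳ (toℕ g)) size≤g) (<⇒≱ (toℕ<n g))
      go (suc k) g size≤g+1+k g∈T u↝g with g ≟ out
      ... | yes refl = u↝g
      ... | no g≢out with T-sink g g∈T g≢out
      ...   | w , g→w = go k w size≤w+k (proj₂ (wT-ends g w g→w)) (u↝g ▷ g→w)
        where
          size≤w+k : size ≤ toℕ w + k
          size≤w+k = ≤-trans size≤g+1+k (≤-trans (≤-reflexive (+-suc (toℕ g) k))
                                                  (+-monoˡ-≤ k (acyclic w g (wT-wire g w g→w))))

  PathFrom-input-gate : ∀ {u g l} → label g ≡ l → IsInputLabel l → PathFrom u g → g ≡ u
  PathFrom-input-gate eq isInput start = refl
  PathFrom-input-gate eq isInput (_ ▷ q→g) = ⊥-elim (no-wire-into-input D eq isInput (wT-wire _ _ q→g))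

  module _ (dnnf : IsDNNF D) where

    wT-inputs-disjoint : ∀ {p q w x} → wT p w → wT q w → p ≢ q → varsSub D p x → varsSub D q x → ⊥
    wT-inputs-disjoint {p} {q} {w} p→w q→w p≢q xp xq with label w in eq
    ... | const _ = no-wire-into-input D eq tt (wT-wire p w p→w)
    ... | pos _ = no-wire-into-input D eq tt (wT-wire p w p→w)
    ... | neg _ = no-wire-into-input D eq tt (wT-wire p w p→w)
    ... | and = dnnf w eq p q (wT-wire p w p→w) (wT-wire q w q→w) p≢q _ (xp , xq)
    ... | or with or-one w (proj₂ (wT-ends p w p→w)) eq
    ...   | _ , _ , _ , _ , onlyInput = p≢q (trans (onlyInput p p→w) (sym (onlyInput q q→w)))

    PathFrom-wT-input : ∀ {v w p x} → varsSub D v x → PathFrom v w → w ≢ v →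
                        wT p w → varsSub D p x → PathFrom v p
    PathFrom-wT-input xv start v≢v _ _ = contradiction refl v≢v
    PathFrom-wT-input {p = p} xv (_▷_ {q} v↝q q→w) _ p→w xp with p ≟ q
    ... | yes refl = v↝q
    ... | no p≢q = ⊥-elim (wT-inputs-disjoint p→w q→w p≢q xp (varsSub-mono D (PathFrom⇒Reach v↝q) xv))

  FalseLiteralIn : (Fin n → Bool) → (Fin size → Set) → Set
  FalseLiteralIn a P = ∃ λ h → inT h × P h × ∃ λ x → label h ≡ pos x × a x ≡ false

  module _ (nice : IsNice D) (a : Fin n → Bool) (P : Fin size → Set)
           (P-down : ∀ {p w} → wT p w → Eval D a w false → P w → P p) where

    false-literal : ∀ {g b} → inT g → P g → Eval D a g b → b ≡ false → FalseLiteralIn a P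
    false-literal-any : ∀ {us} → (∀ {u} → u ∈ₗ us → inT u × P u) →
                        Any (λ u → Eval D a u false) us → FalseLiteralIn a P
    false-literal-all : ∀ {us u} → u ∈ₗ us → inT u → P u →
                        All (λ u → Eval D a u false) us → FalseLiteralIn a P

    false-literal g∈T Pg (ev-const eq) _ = contradiction eq (proj₁ (proj₂ nice) _ _)
    false-literal g∈T Pg (ev-pos eq) ax = _ , g∈T , Pg , _ , eq , ax
    false-literal g∈T Pg (ev-neg eq) _ = contradiction eq (proj₂ (proj₂ nice) _ _)
    false-literal {g} g∈T Pg e@(ev-and-f eq es) refl = false-literal-any below es
      where
        below : ∀ {u} → u ∈ₗ inputs g → inT u × P u
        below u∈ with and-all g g∈T eq _ u∈
        ... | u∈T , u→g = u∈T , P-down u→g e Pg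
    false-literal {g} g∈T Pg e@(ev-or-f eq es) refl with or-one g g∈T eq
    ... | _ , u∈ , u∈T , u→g , _ = false-literal-all u∈ u∈T (P-down u→g e Pg) es

    false-literal-any below (here e) with below (here refl)
    ... | u∈T , Pu = false-literal u∈T Pu e refl
    false-literal-any below (there es) = false-literal-any (below ∘ there) es

    false-literal-all (here refl) u∈T Pu (e ∷ _) = false-literal u∈T Pu e refl
    false-literal-all (there u∈) u∈T Pu (_ ∷ es) = false-literal-all u∈ u∈T Pu es

EndpointWith : ∀ {n ℓ} → (Fin n → Set ℓ) → Fin n × Fin n → Set ℓ
EndpointWith P (x , y) = ∃ λ z → (z ≡ x ⊎ z ≡ y) × P z

pickEndpoints : ∀ {n ℓ} (P : Fin n → Set ℓ) (M : List (Fin n × Fin n)) → Unique (endpoints M) →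
                All (EndpointWith P) M →
                Σ (Subset n) λ I → ∣ I ∣ ≡ length M × (∀ z → z ∈ I → P z)
pickEndpoints {n} P M distinct choices =
  map₂ (map₂ (λ inI z z∈I → proj₁ (inI z z∈I))) (go M distinct choices)
  where
    go : ∀ M → Unique (endpoints M) → All (EndpointWith P) M →
         Σ (Subset n) λ I → ∣ I ∣ ≡ length M × (∀ z → z ∈ I → P z × z ∈ₗ endpoints M)
    go [] [] [] = Subset.⊥ , ∣⊥∣≡0 n , λ _ z∈⊥ → contradiction z∈⊥ ∉⊥
    go ((x , y) ∷ M) ((_ ∷ x∉) ∷ y∉ ∷ distinct) ((z , z∈xy , Pz) ∷ choices) with go M distinct choices
    ... | I , ∣I∣≡ , inI = ⁅ z ⁆ ∪ I , trans (∣⁅x⁆∪p∣≡1+∣p∣ I z∉I) (cong suc ∣I∣≡) , inI′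
      where
        z∉I : z ∉ I
        z∉I z∈I = [ (λ { refl → All.lookup x∉ z∈M refl }) , (λ { refl → All.lookup y∉ z∈M refl }) ]′ z∈xy
          where z∈M = proj₂ (inI z z∈I)

        inI′ : ∀ w → w ∈ ⁅ z ⁆ ∪ I → P w × w ∈ₗ x ∷ y ∷ endpoints M
        inI′ w w∈ with x∈p∪q⁻ ⁅ z ⁆ I w∈
        ... | inj₂ w∈I = map₂ (λ w∈M → there (there w∈M)) (inI w w∈I)
        ... | inj₁ w∈⁅z⁆ with x∈⁅y⁆⇒x≡y z w∈⁅z⁆
        ...   | refl = Pz , [ (λ { refl → here refl }) , (λ { refl → there (here refl) }) ]′ z∈xy

Forced : ∀ {n} (D : NNF n) → Fin (NNF.size D) → Fin n → Set₁
Forced D v x = (T : Certificate D) → Certificate.inT T v → Certificate.varsT T x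

module _ {n} (D : NNF n) (nice : IsNice D) (v : Fin (NNF.size D)) where
  open NNF D

  forced-if-false : ∀ {x} (a : Fin n → Bool) → (∀ {z} → a z ≡ false → z ≡ x) →
                    Eval D a v false → Forced D v x
  forced-if-false a onlyX v-false T v∈T =
    conclude (false-literal T nice a (λ _ → ⊤) (λ _ _ _ → tt) v∈T tt v-false refl)
    where
      conclude : FalseLiteralIn T a (λ _ → ⊤) → Certificate.varsT T _
      conclude (h , h∈T , _ , z , h=z , az) with onlyX az
      ... | refl = h , h∈T , inj₁ h=z

  forced-if-true : IsDNNF D → ∀ {x y} (a : Fin n → Bool) → (∀ {z} → a z ≡ false → z ≡ x ⊎ z ≡ y) →
                   varsSub D v x → Eval D a v true → Eval D a out false → Forced D v y
  forced-if-true dnnf {x} {y} a onlyXY xv v-true out-false T v∈T =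
    conclude (false-literal T nice a OnPath down out-in (λ _ → PathFrom-toOut T v∈T start) out-false refl)
    where
      open Certificate T

      OnPath : Fin size → Set
      OnPath g = varsSub D g x → PathFrom T v g

      down : ∀ {p w} → wT p w → Eval D a w false → OnPath w → OnPath p
      down p→w w-false onPath xp =
        PathFrom-wT-input T dnnf xv (onPath (varsSub-mono D (step (wT-wire _ _ p→w) here) xp))
                          (λ { refl → contradiction (eval-deterministic D a v-true w-false) λ () }) p→w xp

      conclude : FalseLiteralIn T a OnPath → varsT y
      conclude (h , h∈T , onPath , z , h=z , az) with onlyXY az
      ... | inj₂ refl = h , h∈T , inj₁ h=z
      ... | inj₁ refl with PathFrom-input-gate T h=z tt (onPath (h , here , inj₁ h=z))
      ...   | refl = contradiction (trans (eval-deterministic D a v-true (ev-pos h=z)) az) λ ()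

  forcedEndpoint : IsDNNF D → (G : Graph n) → (∀ a → Sat D a ⇔ GraphCNF G a) →
                   ∀ {x y} → Graph.Adj G x y → varsSub D v x → ¬ varsSub D v y →
                   EndpointWith (Forced D v) (x , y)
  forcedEndpoint dnnf G iff {x} {y} xy xv y∉v = [ whenTrue , whenFalse ]′ (eval-total D a₁ v)
    where
      a₁ a₂ : Fin n → Bool
      a₁ = setFalse x (λ _ → true)
      a₂ = setFalse y a₁

      onlyX : ∀ {z} → a₁ z ≡ false → z ≡ x
      onlyX {z} a₁z = [ (λ z≡x → z≡x) , (λ ()) ]′ (setFalse-false⁻ x _ {z} a₁z)

      onlyXY : ∀ {z} → a₂ z ≡ false → z ≡ x ⊎ z ≡ y
      onlyXY {z} a₂z = [ inj₂ , inj₁ ∘ onlyX ]′ (setFalse-false⁻ y a₁ {z} a₂z)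

      agree : AgreeBelow D v
      agree {z} zv = sym (setFalse-other y a₁ {z} (λ { refl → y∉v zv }))

      clauseViolated : ¬ GraphCNF G a₂
      clauseViolated cnf =
        [ clash (setFalse-keeps-false y a₁ {x} (setFalse-same x _)) , clash (setFalse-same y a₁) ]′ (cnf x y xy)
        where
          clash : ∀ {b} → b ≡ false → b ≡ true → ⊥
          clash refl ()

      out-false : Eval D a₂ out false
      out-false =
        [ (λ sat → ⊥-elim (clauseViolated (Equivalence.to (iff a₂) sat))) , (λ e → e) ]′ (eval-total D a₂ out)

      whenFalse : Eval D a₁ v false → EndpointWith (Forced D v) (x , y)
      whenFalse v-false = x , inj₁ refl , forced-if-false a₁ onlyX v-false

      whenTrue : Eval D a₁ v true → EndpointWith (Forced D v) (x , y)
      whenTrue v-true = y , inj₂ refl , forced-if-true dnnf a₂ onlyXY xv (eval-cong D agree v-true) out-false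

corollary11 : ∀ {n} (G : Graph n) → 2 ≤ n → NoIsolated G →
    (D : NNF n) → IsNice D → IsDNNF D →
    (∀ a → Sat D a ⇔ GraphCNF G a) →
    (v : Fin (NNF.size D)) →
    (M : List (Fin n × Fin n)) →
    MatchingBetween G (varsSub D v) (λ y → vars D y × ¬ varsSub D v y) M →
    Σ (Subset n) λ I → ∣ I ∣ ≡ length M ×
    ((T : Certificate D) → Certificate.inT T v →
    ∀ x → x ∈ I → Certificate.varsT T x)
corollary11 {n} G _ _ D nice dnnf iff v M (edges , distinct) =
  map₂ (map₂ (λ forced T v∈T x x∈I → forced x x∈I T v∈T)) forcedSet
  where
    forcedSet : Σ (Subset n) λ I → ∣ I ∣ ≡ length M × (∀ x → x ∈ I → Forced D v x)
    forcedSet = pickEndpoints (Forced D v) M distinct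
      (All.map (λ { (xy , xv , _ , y∉v) → forcedEndpoint D nice v dnnf G iff xy xv y∉v }) edges)
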